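{- For every finite simple graph $G$, $G$ and its barycentric subdivision $Bd(G)$ have the same s-homotopy type.
   Context: Graphs are finite, undirected, without loops or multiple edges, considered up to isomorphism. $N_G(g)$ is the set of neighbours of $g$, $N_G[g]=N_G(g)\cup\{g\}$; vertex sets are identified with induced subgraphs. A vertex $g$ is dominated by $g'\ne g$ if $N_G[g]\subseteq N_G[g']$. A graph is dismantlable if it has one vertex, or its vertices can be listed $g_1,\dots,g_n$ so that each $g_i$ ($2\le i\le n$) is dominated by another vertex in the subgraph induced by $\{g_1,\dots,g_i\}$. A vertex $g$ is s-dismantlable in $G$ if $N_G(g)$ is dismantlable. Two graphs have the same s-homotopy type if one can be transformed into the other by a finite sequence of deletions of s-dismantlable vertices and additions of new vertices that are s-dismantlable in the enlarged graph. The barycentric subdivision $Bd(G)$ is the graph whose vertices are the nonempty complete subgraphs of $G$, two distinct such subgraphs being adjacent iff one is contained in the other. -}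

module Defs where

open import Data.Bool using (Bool; true; false; _∧_; _∨_; not; if_then_else_; T)
open import Data.Bool.Properties using (∨-comm)
open import Data.Nat using (ℕ; zero; suc)
open import Data.Fin using (Fin; zero; suc; punchIn; _≟_)
open import Data.Vec using (Vec; []; _∷_; lookup)
open import Data.List using (List; []; _∷_; [_]; _++_; map; length; filterᵇ; allFin; foldr)
open import Data.List.Membership.Propositional using (_∈_)
open import Data.List.Relation.Unary.Unique.Propositional using (Unique)
open import Data.Product using (Σ; _×_; _,_; ∃)
open import Data.Sum using (_⊎_)
open import Function.Bundles using (Bijection; _⤖_)
open import Relation.Nullary.Decidable using (⌊_⌋)
open import Relation.Binary.PropositionalEquality using (_≡_; refl; cong; trans; sym)
open import Relation.Binary.Construct.Closure.ReflexiveTransitive using (Star)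

record Graph : Set where
  constructor graph
  field
    order  : ℕ
    adj    : Fin order → Fin order → Bool
    adj-sym   : ∀ x y → adj x y ≡ adj y x
    adj-irrefl : ∀ x → adj x x ≡ false

open Graph public

Vertex : Graph → Set
Vertex G = Fin (order G)

Adj : (G : Graph) → Vertex G → Vertex G → Set
Adj G x y = adj G x y ≡ true

Iso : Graph → Graph → Set
Iso G H = Σ (Vertex G ⤖ Vertex H) λ f →
  ∀ x y → adj H (Bijection.to f x) (Bijection.to f y) ≡ adj G x y

-- A (finite) vertex set is given by a list of vertices; the induced
-- subgraph on it is used implicitly: all neighbourhoods are taken inside it.

DominatedIn : (G : Graph) → List (Vertex G) → Vertex G → Vertex G → Set
DominatedIn G T g g' =
  ∀ x → x ∈ T → (x ≡ g ⊎ Adj G g x) → (x ≡ g' ⊎ Adj G g' x)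

-- A dismantling listing, written in REVERSE order  g_m ∷ … ∷ g_1 :
-- every g_i with i ≥ 2 is dominated by another vertex (some g_j, j < i)
-- in the subgraph induced by {g_1,…,g_i}.
data Listing (G : Graph) : List (Vertex G) → Set where
  one  : ∀ g → Listing G [ g ]
  more : ∀ g g' rest → g' ∈ rest → DominatedIn G (g ∷ rest) g g' →
         Listing G rest → Listing G (g ∷ rest)

Dismantlable : (G : Graph) → (Vertex G → Bool) → Set
Dismantlable G S = Σ (List (Vertex G)) λ L →
  Unique L × Listing G L × (∀ x → (x ∈ L → S x ≡ true) × (S x ≡ true → x ∈ L))

SDismantlable : (G : Graph) → Vertex G → Set
SDismantlable G g = Dismantlable G (adj G g)

deleteVertex : (G : Graph) → Vertex G → Graph
deleteVertex (graph zero adj s i) ()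
deleteVertex (graph (suc m) adj s i) v =
  graph m (λ x y → adj (punchIn v x) (punchIn v y))
          (λ x y → s (punchIn v x) (punchIn v y))
          (λ x → i (punchIn v x))

data SStep (G H : Graph) : Set where
  iso    : Iso G H → SStep G H
  delete : (v : Vertex G) → SDismantlable G v → Iso (deleteVertex G v) H → SStep G H
  add    : (v : Vertex H) → SDismantlable H v → Iso (deleteVertex H v) G → SStep G H

SameSHomotopyType : Graph → Graph → Set
SameSHomotopyType = Star SStep

allSubsets : (n : ℕ) → List (Vec Bool n)
allSubsets zero = [ [] ]
allSubsets (suc n) = map (false ∷_) (allSubsets n) ++ map (true ∷_) (allSubsets n)

nonemptyᵇ : ∀ {n} → Vec Bool n → Bool
nonemptyᵇ [] = false
nonemptyᵇ (b ∷ v) = b ∨ nonemptyᵇ v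

_⊆ᵇ_ : ∀ {n} → Vec Bool n → Vec Bool n → Bool
[] ⊆ᵇ [] = true
(a ∷ u) ⊆ᵇ (b ∷ v) = (not a ∨ b) ∧ (u ⊆ᵇ v)

_==ᵇ_ : ∀ {n} → Vec Bool n → Vec Bool n → Bool
[] ==ᵇ [] = true
(a ∷ u) ==ᵇ (b ∷ v) = (if a then b else not b) ∧ (u ==ᵇ v)

==ᵇ-refl : ∀ {n} (u : Vec Bool n) → (u ==ᵇ u) ≡ true
==ᵇ-refl [] = refl
==ᵇ-refl (false ∷ u) = ==ᵇ-refl u
==ᵇ-refl (true ∷ u) = ==ᵇ-refl u

==ᵇ-sym : ∀ {n} (u v : Vec Bool n) → (u ==ᵇ v) ≡ (v ==ᵇ u)
==ᵇ-sym [] [] = refl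
==ᵇ-sym (false ∷ u) (false ∷ v) = ==ᵇ-sym u v
==ᵇ-sym (false ∷ u) (true ∷ v) = refl
==ᵇ-sym (true ∷ u) (false ∷ v) = refl
==ᵇ-sym (true ∷ u) (true ∷ v) = ==ᵇ-sym u v

allᵇ : ∀ {A : Set} → (A → Bool) → List A → Bool
allᵇ p = foldr (λ a b → p a ∧ b) true

isCliqueᵇ : (G : Graph) → Vec Bool (order G) → Bool
isCliqueᵇ G S = allᵇ (λ i → allᵇ (λ j →
    not (lookup S i ∧ lookup S j) ∨ ⌊ i ≟ j ⌋ ∨ adj G i j)
  (allFin (order G))) (allFin (order G))

cliques : (G : Graph) → List (Vec Bool (order G))
cliques G = filterᵇ (λ S → nonemptyᵇ S ∧ isCliqueᵇ G S) (allSubsets (order G))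

bdAdj : ∀ {n} → Vec Bool n → Vec Bool n → Bool
bdAdj S S' = not (S ==ᵇ S') ∧ ((S ⊆ᵇ S') ∨ (S' ⊆ᵇ S))

bdAdj-sym : ∀ {n} (S S' : Vec Bool n) → bdAdj S S' ≡ bdAdj S' S
bdAdj-sym S S' rewrite ==ᵇ-sym S S' | ∨-comm (S ⊆ᵇ S') (S' ⊆ᵇ S) = refl

bdAdj-irrefl : ∀ {n} (S : Vec Bool n) → bdAdj S S ≡ false
bdAdj-irrefl S rewrite ==ᵇ-refl S = refl

-- Bd(G): vertices are the nonempty complete subgraphs of G (indexed by
-- their position in the list 'cliques G'), adjacent iff distinct and one
-- is contained in the other.
Bd : Graph → Graph
Bd G = graph (length (cliques G))
  (λ i j → bdAdj (Data.List.lookup (cliques G) i) (Data.List.lookup (cliques G) j))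
  (λ i j → bdAdj-sym (Data.List.lookup (cliques G) i) (Data.List.lookup (cliques G) j))
  (λ i → bdAdj-irrefl (Data.List.lookup (cliques G) i))

-- G and Bd(G) both sit inside one graph whose vertices are the vertices of G
-- together with its nonempty cliques, a vertex v being adjacent to a clique σ
-- iff σ ⊆ N[v], i.e. iff σ ∪ {v} is a clique.  Starting from G, add the cliques
-- one at a time: the neighbourhood of σ is a cone with apex any b ∈ σ, hence
-- dismantlable.  Then delete the vertices of G one at a time.  In the
-- neighbourhood of v, a largest clique σ not containing v is dominated by
-- σ ∪ {v}; removing these cliques in order of decreasing size leaves a cone
-- with apex {v}.
module Submission where

open import Defs
open import Data.Bool using (Bool; true; false; _∧_; _∨_; not)
import Data.Bool.Properties as Bool
open import Data.Empty using (⊥; ⊥-elim)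
open import Data.Fin using (Fin; zero; suc)
import Data.Fin.Properties as Fin
open import Data.Fin.Subset using (Subset; Nonempty; _⊂_; ⁅_⁆; _∪_; ∣_∣)
  renaming (_∈_ to _∈ₛ_; _∉_ to _∉ₛ_; _⊆_ to _⊆ₛ_)
open import Data.Fin.Subset.Properties
  using (drop-∷-⊆; s⊂s; x∈⁅x⁆; x∈⁅y⁆⇒x≡y; p⊆p∪q; q⊆p∪q; x∈p∪q⁻; p⊂q⇒∣p∣<∣q∣;
         _∈?_)
open import Data.List
  using (List; []; _∷_; [_]; _∷ʳ_; _++_; map; length; lookup; filter; allFin)
open import Data.List.Extrema.Nat using (argmax; argmax-sel; f[⊥]≤f[argmax]; f[xs]≤f[argmax])
open import Data.List.Membership.Propositional using (_∈_)
open import Data.List.Membership.Propositional.Properties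
  using (∈-lookup; ∈-filter⁺; ∈-filter⁻; ∈-++⁺ˡ; ∈-++⁺ʳ; ∈-++⁻; ∈-map⁺; ∈-map⁻;
         ∈-allFin)
open import Data.List.Properties using (filter-notAll)
open import Data.List.Relation.Unary.All as All using (All; []; _∷_)
import Data.List.Relation.Unary.All.Properties as All
open import Data.List.Relation.Unary.Any as Any using (here; there; index)
open import Data.List.Relation.Unary.Any.Properties using (lookup-index; ++-comm)
open import Data.List.Relation.Unary.AllPairs using ([]; _∷_)
open import Data.List.Relation.Unary.Unique.Propositional using (Unique)
import Data.List.Relation.Unary.Unique.Propositional.Properties as Unique
open import Data.Nat using (ℕ; zero; suc; _≤_; _<_)
open import Data.Nat.Induction using (<-wellFounded)
open import Data.Nat.Properties using (<⇒≱)
open import Data.Product using (Σ; _×_; _,_; proj₁; proj₂)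
open import Data.Sum using (_⊎_; inj₁; inj₂)
import Data.Sum.Properties as Sum
open import Data.Vec using ([]; _∷_; here; there; tabulate)
import Data.Vec.Properties as Vec
open import Function.Base using (id; _∘_)
open import Function.Bundles using (Inverse; Equivalence; mk↔ₛ′)
open import Function.Properties.Bijection using (⤖⇒↔)
open import Function.Properties.Inverse using (↔⇒⤖; ↔-sym)
open import Induction.WellFounded using (Acc; acc)
open import Relation.Nullary using (¬_; Dec; yes; no; ¬?)
open import Relation.Nullary.Decidable using (⌊_⌋; decidable-stable)
open import Relation.Unary using (Decidable)
open import Relation.Binary.Definitions using (DecidableEquality)
open import Relation.Binary.PropositionalEquality
  using (_≡_; _≢_; refl; sym; trans; cong; cong₂; subst; subst₂)
open import Relation.Binary.Construct.Closure.ReflexiveTransitive using (Star; ε; _◅_; _◅◅_)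

Iso-sym : ∀ {G H} → Iso G H → Iso H G
Iso-sym {G} {H} (f , pres) = ↔⇒⤖ (↔-sym f↔) , pres⁻¹
  where
  f↔ = ⤖⇒↔ f
  open Inverse f↔ using (from; strictlyInverseˡ)
  pres⁻¹ : ∀ x y → adj G (from x) (from y) ≡ adj H x y
  pres⁻¹ x y = trans (sym (pres (from x) (from y)))
                     (cong₂ (adj H) (strictlyInverseˡ x) (strictlyInverseˡ y))

lookup-injective : ∀ {A : Set} {L : List A} → Unique L →
                   ∀ i j → lookup L i ≡ lookup L j → i ≡ j
lookup-injective (_ ∷ _)  zero    zero    _ = refl
lookup-injective (x∉ ∷ _) zero    (suc j) e = ⊥-elim (All.lookup x∉ (∈-lookup j) e)
lookup-injective (x∉ ∷ _) (suc i) zero    e = ⊥-elim (All.lookup x∉ (∈-lookup i) (sym e))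
lookup-injective (_ ∷ u)  (suc i) (suc j) e = cong suc (lookup-injective u i j e)

inj₁-inj₂-disjoint : ∀ {B C : Set} {xs : List B} {ys : List C} {y} →
                     ¬ (y ∈ map inj₁ xs × y ∈ map inj₂ ys)
inj₁-inj₂-disjoint {xs = xs} {ys} (y∈₁ , y∈₂)
  with ∈-map⁻ inj₁ {xs = xs} y∈₁ | ∈-map⁻ inj₂ {xs = ys} y∈₂
... | _ , _ , refl | _ , _ , ()

inj₂-∈⁻ : ∀ {B C : Set} {ys : List C} {xs : List B} {τ} →
          inj₂ τ ∈ map inj₂ ys ++ map inj₁ xs → τ ∈ ys
inj₂-∈⁻ {ys = ys} {xs} τ∈ with ∈-++⁻ (map inj₂ ys) τ∈
... | inj₁ τ∈ys with ∈-map⁻ inj₂ {xs = ys} τ∈ys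
...   | _ , τ∈ , refl = τ∈
inj₂-∈⁻ {ys = ys} {xs} τ∈ | inj₂ τ∈xs with ∈-map⁻ inj₁ {xs = xs} τ∈xs
...   | _ , _ , ()

-- Induced subgraphs of an ambient graph

module InducedGraphs {A : Set} (_≟_ : DecidableEquality A) (adjᴬ : A → A → Bool)
  (adjᴬ-sym : ∀ x y → adjᴬ x y ≡ adjᴬ y x) (adjᴬ-irrefl : ∀ x → adjᴬ x x ≡ false) where

  induced : List A → Graph
  induced L = graph (length L) (λ i j → adjᴬ (lookup L i) (lookup L j))
    (λ i j → adjᴬ-sym (lookup L i) (lookup L j)) (λ i → adjᴬ-irrefl (lookup L i))

  infix 4 _∼_ _∼⁼_

  _∼_ : A → A → Set
  x ∼ y = adjᴬ x y ≡ true

  _∼⁼_ : A → A → Set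
  x ∼⁼ y = y ≡ x ⊎ x ∼ y

  ∼-irrefl : ∀ {x} → ¬ x ∼ x
  ∼-irrefl {x} x∼x with trans (sym x∼x) (adjᴬ-irrefl x)
  ... | ()

  Dominatedᴬ : (A → Set) → A → A → Set
  Dominatedᴬ P g g' = ∀ y → P y → g ∼⁼ y → g' ∼⁼ y

  data Listingᴬ : List A → Set where
    one  : ∀ g → Listingᴬ [ g ]
    more : ∀ g g' rest → g' ∈ rest → Dominatedᴬ (_∈ g ∷ rest) g g' →
           Listingᴬ rest → Listingᴬ (g ∷ rest)

  Enumerates : List A → (A → Set) → Set
  Enumerates L P = ∀ y → (y ∈ L → P y) × (P y → y ∈ L)

  Dismantlableᴬ : (A → Set) → Set
  Dismantlableᴬ P = Σ (List A) λ L → Unique L × Listingᴬ L × Enumerates L P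

  NbrIn : List A → A → A → Set
  NbrIn L x y = y ∈ L × x ∼ y

  neighbours : List A → A → List A
  neighbours L x = filter (λ y → adjᴬ x y Bool.≟ true) L

  neighbours-unique : ∀ {L} x → Unique L → Unique (neighbours L x)
  neighbours-unique x = Unique.filter⁺ (λ y → adjᴬ x y Bool.≟ true)

  neighbours-enumerates : ∀ L x → Enumerates (neighbours L x) (NbrIn L x)
  neighbours-enumerates L x y =
    ∈-filter⁻ (λ y → adjᴬ x y Bool.≟ true) ,
    λ (y∈L , x∼y) → ∈-filter⁺ (λ y → adjᴬ x y Bool.≟ true) y∈L x∼y

  enumerates-filter : ∀ {E P R} → Enumerates E P → (R? : Decidable R) →
                      Enumerates (filter R? E) (λ y → P y × R y)
  enumerates-filter {E} enum R? y =
    (λ y∈ → let y∈E , ry = ∈-filter⁻ R? {xs = E} y∈ in proj₁ (enum y) y∈E , ry) ,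
    (λ (py , ry) → ∈-filter⁺ R? (proj₂ (enum y) py) ry)

  ≢? : ∀ σ → Decidable (_≢ σ)
  ≢? σ y = ¬? (y ≟ σ)

  filter-≢-shorter : ∀ {σ Ds} → σ ∈ Ds → length (filter (≢? σ) Ds) < length Ds
  filter-≢-shorter {Ds = Ds} σ∈ =
    filter-notAll (≢? _) Ds (Any.map (λ σ≡y y≢σ → y≢σ (sym σ≡y)) σ∈)

  dismantlable-resp : ∀ {P Q} → (∀ y → P y → Q y) → (∀ y → Q y → P y) →
                      Dismantlableᴬ P → Dismantlableᴬ Q
  dismantlable-resp P⇒Q Q⇒P (L , u , l , enum) =
    L , u , l ,
    λ y → (λ y∈L → P⇒Q y (proj₁ (enum y) y∈L)) , (λ qy → proj₂ (enum y) (Q⇒P y qy))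

  cone-listing : ∀ p xs → All (p ∼_) xs → Listingᴬ (xs ∷ʳ p)
  cone-listing p []       []            = one p
  cone-listing p (x ∷ xs) (p∼x ∷ p∼xs) =
    more x p (xs ∷ʳ p) (∈-++⁺ʳ xs (here refl)) dominated (cone-listing p xs p∼xs)
    where
    dominated : Dominatedᴬ (_∈ x ∷ xs ∷ʳ p) x p
    dominated y y∈ _ with ∈-++⁻ (x ∷ xs) y∈
    ... | inj₁ y∈xs        = inj₂ (All.lookup (p∼x ∷ p∼xs) y∈xs)
    ... | inj₂ (here refl) = inj₁ refl

  cone-dismantlable : ∀ {P} E → Unique E → Enumerates E P →
                      ∀ p → P p → (∀ y → P y → y ≢ p → p ∼ y) → Dismantlableᴬ P
  cone-dismantlable {P} E uE enum p pp apex =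
    xs ∷ʳ p , Unique.++⁺ (Unique.filter⁺ (≢? p) {E} uE) ([] ∷ []) p∉xs ,
    cone-listing p xs (All.tabulate λ y∈ →
      let y∈E , y≢p = ∈xs⁻ y∈ in apex _ (proj₁ (enum _) y∈E) y≢p) ,
    λ y → sound y , complete y
    where
    xs = filter (≢? p) E
    ∈xs⁻ : ∀ {y} → y ∈ xs → y ∈ E × y ≢ p
    ∈xs⁻ = ∈-filter⁻ (≢? p) {xs = E}
    p∉xs : ∀ {y} → ¬ (y ∈ xs × y ∈ [ p ])
    p∉xs (p∈xs , here refl) = proj₂ (∈xs⁻ p∈xs) refl
    sound : ∀ y → y ∈ xs ∷ʳ p → P y
    sound y y∈ with ∈-++⁻ xs y∈
    ... | inj₁ y∈xs        = proj₁ (enum y) (proj₁ (∈xs⁻ y∈xs))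
    ... | inj₂ (here refl) = pp
    complete : ∀ y → P y → y ∈ xs ∷ʳ p
    complete y py with y ≟ p
    ... | yes refl = ∈-++⁺ʳ xs (here refl)
    ... | no y≢p   = ∈-++⁺ˡ (∈-filter⁺ (≢? p) (proj₂ (enum y) py) y≢p)

  dominated-dismantlable : ∀ {P x x'} → P x → P x' → x' ≢ x → Dominatedᴬ P x x' →
                           Dismantlableᴬ (λ y → P y × y ≢ x) → Dismantlableᴬ P
  dominated-dismantlable {P} {x} {x'} px px' x'≢x dom (L , u , l , enum) =
    x ∷ L , All.tabulate (λ y∈L x≡y → proj₂ (proj₁ (enum _) y∈L) (sym x≡y)) ∷ u ,
    more x x' L (proj₂ (enum x') (px' , x'≢x)) (λ y y∈ → dom y (sound y y∈)) l ,
    λ y → sound y , complete y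
    where
    sound : ∀ y → y ∈ x ∷ L → P y
    sound y (here refl) = px
    sound y (there y∈L) = proj₁ (proj₁ (enum y) y∈L)
    complete : ∀ y → P y → y ∈ x ∷ L
    complete y py with y ≟ x
    ... | yes refl = here refl
    ... | no y≢x   = there (proj₂ (enum y) (py , y≢x))

  -- Q ∪ Ds is dismantled by removing the elements of Ds heaviest first.
  module _ {Q Bad : A → Set} (Bad⇒¬Q : ∀ {y} → Bad y → ¬ Q y) (weight : A → ℕ)
    (dominator : ∀ Ds σ → All Bad Ds → σ ∈ Ds → All (λ τ → weight τ ≤ weight σ) Ds →
                 Σ A λ σ' → Q σ' × Dominatedᴬ (λ y → Q y ⊎ y ∈ Ds) σ σ')
    (Q-dismantlable : Dismantlableᴬ Q) where

    heaviest : ∀ β Ds → Σ A λ σ → σ ∈ β ∷ Ds × All (λ τ → weight τ ≤ weight σ) (β ∷ Ds)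
    heaviest β Ds = argmax weight β Ds , selected (argmax-sel weight β Ds) ,
                    f[⊥]≤f[argmax] {f = weight} β Ds ∷ f[xs]≤f[argmax] {f = weight} β Ds
      where
      selected : ∀ {σ} → σ ≡ β ⊎ σ ∈ Ds → σ ∈ β ∷ Ds
      selected (inj₁ refl) = here refl
      selected (inj₂ σ∈Ds) = there σ∈Ds

    module _ {σ : A} (¬Qσ : ¬ Q σ) {Ds : List A} where

      ∪-filter⁻ : ∀ y → Q y ⊎ y ∈ filter (≢? σ) Ds → (Q y ⊎ y ∈ Ds) × y ≢ σ
      ∪-filter⁻ y (inj₁ qy) = inj₁ qy , λ { refl → ¬Qσ qy }
      ∪-filter⁻ y (inj₂ y∈) =
        let y∈Ds , y≢σ = ∈-filter⁻ (≢? σ) {xs = Ds} y∈ in inj₂ y∈Ds , y≢σ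

      ∪-filter⁺ : ∀ y → (Q y ⊎ y ∈ Ds) × y ≢ σ → Q y ⊎ y ∈ filter (≢? σ) Ds
      ∪-filter⁺ y (inj₁ qy   , _)   = inj₁ qy
      ∪-filter⁺ y (inj₂ y∈Ds , y≢σ) = inj₂ (∈-filter⁺ (≢? σ) y∈Ds y≢σ)

    dismantlable-∪ : ∀ Ds → All Bad Ds → Dismantlableᴬ (λ y → Q y ⊎ y ∈ Ds)
    dismantlable-∪ Ds bad = dismantle Ds bad (<-wellFounded (length Ds))
      where
      dismantle : ∀ Ds → All Bad Ds → Acc _<_ (length Ds) → Dismantlableᴬ (λ y → Q y ⊎ y ∈ Ds)
      dismantle []        _   _         =
        dismantlable-resp (λ _ → inj₁) (λ { _ (inj₁ qy) → qy ; _ (inj₂ ()) }) Q-dismantlable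
      dismantle (β ∷ Ds₀) bad (acc rec) with heaviest β Ds₀
      ... | σ , σ∈ , heavy with dominator (β ∷ Ds₀) σ bad σ∈ heavy
      ... | σ' , qσ' , dom =
        dominated-dismantlable (inj₂ σ∈) (inj₁ qσ') (λ { refl → ¬Qσ qσ' }) dom
          (dismantlable-resp (∪-filter⁻ ¬Qσ) (∪-filter⁺ ¬Qσ)
            (dismantle _ (All.filter⁺ (≢? σ) bad) (rec (filter-≢-shorter σ∈))))
        where
        ¬Qσ = Bad⇒¬Q (All.lookup bad σ∈)

  module _ {L : List A} (uL : Unique L) where

    indices : (M : List A) → All (_∈ L) M → List (Fin (length L))
    indices []      []         = []
    indices (_ ∷ M) (y∈L ∷ ps) = index y∈L ∷ indices M ps

    ∈-indices⁻ : ∀ {M} ps {j} → j ∈ indices M ps → lookup L j ∈ M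
    ∈-indices⁻ (y∈L ∷ _)  (here refl) = here (sym (lookup-index y∈L))
    ∈-indices⁻ (_   ∷ ps) (there j∈)  = there (∈-indices⁻ ps j∈)

    ∈-indices⁺ : ∀ {M} ps {y} → y ∈ M →
                 Σ (Fin (length L)) λ j → j ∈ indices M ps × lookup L j ≡ y
    ∈-indices⁺ (y∈L ∷ _)  (here refl) = index y∈L , here refl , sym (lookup-index y∈L)
    ∈-indices⁺ (_   ∷ ps) (there y∈)  =
      let j , j∈ , eq = ∈-indices⁺ ps y∈ in j , there j∈ , eq

    indices-unique : ∀ {M} ps → Unique M → Unique (indices M ps)
    indices-unique []         []          = []
    indices-unique (y∈L ∷ ps) (y∉ ∷ uM) =
      All.tabulate (λ j∈ eq → All.lookup y∉ (∈-indices⁻ ps j∈)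
                                (trans (lookup-index y∈L) (cong (lookup L) eq)))
        ∷ indices-unique ps uM

    lookup-∼⁼⁺ : ∀ {i k} → k ≡ i ⊎ Adj (induced L) i k → lookup L i ∼⁼ lookup L k
    lookup-∼⁼⁺ (inj₁ refl) = inj₁ refl
    lookup-∼⁼⁺ (inj₂ i∼k)  = inj₂ i∼k

    lookup-∼⁼⁻ : ∀ {i k} → lookup L i ∼⁼ lookup L k → k ≡ i ⊎ Adj (induced L) i k
    lookup-∼⁼⁻ (inj₁ eq)  = inj₁ (lookup-injective uL _ _ eq)
    lookup-∼⁼⁻ (inj₂ i∼k) = inj₂ i∼k

    indices-listing : ∀ {M} ps → Listingᴬ M → Listing (induced L) (indices M ps)
    indices-listing (y∈L ∷ []) (one _) = one (index y∈L)
    indices-listing (g∈L ∷ ps) (more g g' rest g'∈ dom l) with ∈-indices⁺ ps g'∈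
    ... | j , j∈ , lookup-j≡g' =
      more (index g∈L) j (indices rest ps) j∈ dominated (indices-listing ps l)
      where
      dom′ : Dominatedᴬ (_∈ g ∷ rest) (lookup L (index g∈L)) (lookup L j)
      dom′ = subst₂ (Dominatedᴬ (_∈ g ∷ rest)) (lookup-index g∈L) (sym lookup-j≡g') dom
      dominated : DominatedIn (induced L) (index g∈L ∷ indices rest ps) (index g∈L) j
      dominated k k∈ g∼⁼k =
        lookup-∼⁼⁻ (dom′ (lookup L k) (∈-indices⁻ (g∈L ∷ ps) k∈) (lookup-∼⁼⁺ g∼⁼k))

    dismantlable-induced : (s : A → Bool) → Dismantlableᴬ (λ y → y ∈ L × s y ≡ true) →
                           Dismantlable (induced L) (λ j → s (lookup L j))
    dismantlable-induced s (M , uM , lM , enum) =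
      indices M ps , indices-unique ps uM , indices-listing ps lM , λ j → sound j , complete j
      where
      ps = All.tabulate (λ y∈M → proj₁ (proj₁ (enum _) y∈M))
      sound : ∀ j → j ∈ indices M ps → s (lookup L j) ≡ true
      sound j j∈ = proj₂ (proj₁ (enum _) (∈-indices⁻ ps j∈))
      complete : ∀ j → s (lookup L j) ≡ true → j ∈ indices M ps
      complete j sj with ∈-indices⁺ ps (proj₂ (enum _) (∈-lookup j , sj))
      ... | j' , j'∈ , eq = subst (_∈ indices M ps) (lookup-injective uL j' j eq) j'∈

  head-sdismantlable : ∀ {x L} → Unique (x ∷ L) → Dismantlableᴬ (NbrIn L x) →
                       SDismantlable (induced (x ∷ L)) zero
  head-sdismantlable {x} {L} u d =
    dismantlable-induced u (adjᴬ x) (dismantlable-resp widen narrow d)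
    where
    widen : ∀ y → NbrIn L x y → y ∈ x ∷ L × x ∼ y
    widen _ (y∈L , x∼y) = there y∈L , x∼y
    narrow : ∀ y → y ∈ x ∷ L × x ∼ y → NbrIn L x y
    narrow _ (here refl , x∼x) = ⊥-elim (∼-irrefl x∼x)
    narrow _ (there y∈L , x∼y) = y∈L , x∼y

  -- punchIn zero is suc, so deleting the head leaves the tail verbatim.
  delete-head-Iso : ∀ x L → Iso (deleteVertex (induced (x ∷ L)) zero) (induced L)
  delete-head-Iso x L = ↔⇒⤖ (mk↔ₛ′ id id (λ _ → refl) (λ _ → refl)) , λ _ _ → refl

  add-step : ∀ {x L} → Unique (x ∷ L) → Dismantlableᴬ (NbrIn L x) →
             SStep (induced L) (induced (x ∷ L))
  add-step {x} {L} u d = add zero (head-sdismantlable u d) (delete-head-Iso x L)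

  delete-step : ∀ {x L} → Unique (x ∷ L) → Dismantlableᴬ (NbrIn L x) →
                SStep (induced (x ∷ L)) (induced L)
  delete-step {x} {L} u d = delete zero (head-sdismantlable u d) (delete-head-Iso x L)

  module _ (H : Graph) {L : List A} (uL : Unique L) (e : Vertex H → A)
    (e-injective : ∀ x y → e x ≡ e y → x ≡ y) (e∈L : ∀ x → e x ∈ L)
    (e-onto : ∀ y → y ∈ L → Σ (Vertex H) λ x → e x ≡ y)
    (e-adj : ∀ x y → adjᴬ (e x) (e y) ≡ adj H x y) where

    embedding-Iso : Iso H (induced L)
    embedding-Iso = ↔⇒⤖ (mk↔ₛ′ to from to∘from from∘to) , pres
      where
      to : Vertex H → Fin (length L)
      to x = index (e∈L x)
      from : Fin (length L) → Vertex H
      from j = proj₁ (e-onto (lookup L j) (∈-lookup j))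
      e∘from : ∀ j → e (from j) ≡ lookup L j
      e∘from j = proj₂ (e-onto (lookup L j) (∈-lookup j))
      to∘from : ∀ j → to (from j) ≡ j
      to∘from j = lookup-injective uL _ _ (trans (sym (lookup-index (e∈L (from j)))) (e∘from j))
      from∘to : ∀ x → from (to x) ≡ x
      from∘to x = e-injective _ _ (trans (e∘from (to x)) (sym (lookup-index (e∈L x))))
      pres : ∀ x y → adjᴬ (lookup L (to x)) (lookup L (to y)) ≡ adj H x y
      pres x y = trans (sym (cong₂ adjᴬ (lookup-index (e∈L x)) (lookup-index (e∈L y))))
                       (e-adj x y)

  same-members-Iso : ∀ {L L'} → Unique L → Unique L' → (∀ {y} → y ∈ L → y ∈ L') →
                     (∀ {y} → y ∈ L' → y ∈ L) → Iso (induced L) (induced L')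
  same-members-Iso {L} uL uL' L⊆L' L'⊆L =
    embedding-Iso (induced L) uL' (lookup L) (lookup-injective uL) (λ i → L⊆L' (∈-lookup i))
      (λ y y∈L' → index (L'⊆L y∈L') , sym (lookup-index (L'⊆L y∈L'))) (λ _ _ → refl)

⊆ᵇ⇒⊆ : ∀ {n} (S T : Subset n) → (S ⊆ᵇ T) ≡ true → S ⊆ₛ T
⊆ᵇ⇒⊆ (true  ∷ S) (true  ∷ T) _ here       = here
⊆ᵇ⇒⊆ (true  ∷ S) (true  ∷ T) e (there x∈) = there (⊆ᵇ⇒⊆ S T e x∈)
⊆ᵇ⇒⊆ (false ∷ S) (_     ∷ T) e (there x∈) = there (⊆ᵇ⇒⊆ S T e x∈)

⊆⇒⊆ᵇ : ∀ {n} (S T : Subset n) → S ⊆ₛ T → (S ⊆ᵇ T) ≡ true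
⊆⇒⊆ᵇ []          []          _   = refl
⊆⇒⊆ᵇ (true  ∷ S) (true  ∷ T) S⊆T = ⊆⇒⊆ᵇ S T (drop-∷-⊆ S⊆T)
⊆⇒⊆ᵇ (false ∷ S) (_     ∷ T) S⊆T = ⊆⇒⊆ᵇ S T (drop-∷-⊆ S⊆T)
⊆⇒⊆ᵇ (true  ∷ S) (false ∷ T) S⊆T with S⊆T here
... | ()

==ᵇ⇒≡ : ∀ {n} (S T : Subset n) → (S ==ᵇ T) ≡ true → S ≡ T
==ᵇ⇒≡ []          []          _ = refl
==ᵇ⇒≡ (true  ∷ S) (true  ∷ T) e = cong (true ∷_) (==ᵇ⇒≡ S T e)
==ᵇ⇒≡ (false ∷ S) (false ∷ T) e = cong (false ∷_) (==ᵇ⇒≡ S T e)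

==ᵇ-false⇒≢ : ∀ {n} {S T : Subset n} → (S ==ᵇ T) ≡ false → S ≢ T
==ᵇ-false⇒≢ {S = S} S==S refl with trans (sym S==S) (==ᵇ-refl S)
... | ()

Comparable : ∀ {n} → Subset n → Subset n → Set
Comparable S T = S ⊆ₛ T ⊎ T ⊆ₛ S

bdAdj⇒comparable : ∀ {n} (S T : Subset n) → bdAdj S T ≡ true → S ≢ T × Comparable S T
bdAdj⇒comparable S T e with S ==ᵇ T in S==T | S ⊆ᵇ T in S⊆T | T ⊆ᵇ S in T⊆S
... | false | true  | _    = ==ᵇ-false⇒≢ S==T , inj₁ (⊆ᵇ⇒⊆ S T S⊆T)
... | false | false | true = ==ᵇ-false⇒≢ S==T , inj₂ (⊆ᵇ⇒⊆ T S T⊆S)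

comparable⇒bdAdj : ∀ {n} (S T : Subset n) → S ≢ T → Comparable S T → bdAdj S T ≡ true
comparable⇒bdAdj S T S≢T S~T with S ==ᵇ T in S==T
... | true = ⊥-elim (S≢T (==ᵇ⇒≡ S T S==T))
... | false with S~T
...   | inj₁ S⊆T rewrite ⊆⇒⊆ᵇ S T S⊆T = refl
...   | inj₂ T⊆S rewrite ⊆⇒⊆ᵇ T S T⊆S = Bool.∨-zeroʳ _

⊆∧≢⇒⊂ : ∀ {n} {S T : Subset n} → S ⊆ₛ T → S ≢ T → S ⊂ T
⊆∧≢⇒⊂ {S = []}        {[]}        _   S≢T = ⊥-elim (S≢T refl)
⊆∧≢⇒⊂ {S = true  ∷ S} {true  ∷ T} S⊆T S≢T =
  s⊂s (⊆∧≢⇒⊂ (drop-∷-⊆ S⊆T) (λ eq → S≢T (cong (true ∷_) eq)))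
⊆∧≢⇒⊂ {S = false ∷ S} {false ∷ T} S⊆T S≢T =
  s⊂s (⊆∧≢⇒⊂ (drop-∷-⊆ S⊆T) (λ eq → S≢T (cong (false ∷_) eq)))
⊆∧≢⇒⊂ {S = false ∷ S} {true  ∷ T} S⊆T _   = S⊆T , zero , here , λ ()
⊆∧≢⇒⊂ {S = true  ∷ S} {false ∷ T} S⊆T _ with S⊆T here
... | ()

nonemptyᵇ⇒Nonempty : ∀ {n} (S : Subset n) → nonemptyᵇ S ≡ true → Nonempty S
nonemptyᵇ⇒Nonempty (true  ∷ S) _ = zero , here
nonemptyᵇ⇒Nonempty (false ∷ S) e = let x , x∈ = nonemptyᵇ⇒Nonempty S e in suc x , there x∈

Nonempty⇒nonemptyᵇ : ∀ {n} (S : Subset n) → Nonempty S → nonemptyᵇ S ≡ true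
Nonempty⇒nonemptyᵇ (true  ∷ S) _                  = refl
Nonempty⇒nonemptyᵇ (false ∷ S) (suc x , there x∈) = Nonempty⇒nonemptyᵇ S (x , x∈)

∈-allSubsets : ∀ n (S : Subset n) → S ∈ allSubsets n
∈-allSubsets zero    []          = here refl
∈-allSubsets (suc n) (false ∷ S) = ∈-++⁺ˡ (∈-map⁺ (false ∷_) (∈-allSubsets n S))
∈-allSubsets (suc n) (true  ∷ S) = ∈-++⁺ʳ _ (∈-map⁺ (true ∷_) (∈-allSubsets n S))

allSubsets-unique : ∀ n → Unique (allSubsets n)
allSubsets-unique zero    = [] ∷ []
allSubsets-unique (suc n) =
  Unique.++⁺ (Unique.map⁺ Vec.∷-injectiveʳ (allSubsets-unique n))
             (Unique.map⁺ Vec.∷-injectiveʳ (allSubsets-unique n)) heads-differ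
  where
  heads-differ : ∀ {S} → ¬ (S ∈ map (false ∷_) (allSubsets n) × S ∈ map (true ∷_) (allSubsets n))
  heads-differ (S∈₀ , S∈₁) with ∈-map⁻ (false ∷_) S∈₀ | ∈-map⁻ (true ∷_) S∈₁
  ... | _ , _ , refl | _ , _ , ()

allᵇ⇒ : ∀ {A : Set} (p : A → Bool) xs → allᵇ p xs ≡ true → ∀ {x} → x ∈ xs → p x ≡ true
allᵇ⇒ p (y ∷ xs) e (here refl) with p y
... | true = refl
allᵇ⇒ p (y ∷ xs) e (there x∈) with p y
... | true = allᵇ⇒ p xs e x∈

⇒allᵇ : ∀ {A : Set} (p : A → Bool) xs → (∀ {x} → x ∈ xs → p x ≡ true) → allᵇ p xs ≡ true
⇒allᵇ p []       _   = refl
⇒allᵇ p (y ∷ xs) all rewrite all (here refl) = ⇒allᵇ p xs (λ x∈ → all (there x∈))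

not-∧-∨⇒ : ∀ s t c → (not (s ∧ t) ∨ c) ≡ true → s ≡ true → t ≡ true → c ≡ true
not-∧-∨⇒ true true c e refl refl = e

⇒not-∧-∨ : ∀ s t c → (s ≡ true → t ≡ true → c ≡ true) → (not (s ∧ t) ∨ c) ≡ true
⇒not-∧-∨ false _     _ _ = refl
⇒not-∧-∨ true  false _ _ = refl
⇒not-∧-∨ true  true  _ h = h refl refl

∈-tabulate⁺ : ∀ {n} {f : Fin n → Bool} {x} → f x ≡ true → x ∈ₛ tabulate f
∈-tabulate⁺ {f = f} {x} fx = Vec.lookup⇒[]= x _ (trans (Vec.lookup∘tabulate f x) fx)

∈-tabulate⁻ : ∀ {n} {f : Fin n → Bool} {x} → x ∈ₛ tabulate f → f x ≡ true
∈-tabulate⁻ {f = f} {x} x∈ = trans (sym (Vec.lookup∘tabulate f x)) (Vec.[]=⇒lookup x∈)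

x∈p⇒⁅x⁆⊆p : ∀ {n} {x : Fin n} {p} → x ∈ₛ p → ⁅ x ⁆ ⊆ₛ p
x∈p⇒⁅x⁆⊆p {x = x} {p} x∈p y∈⁅x⁆ =
  subst (_∈ₛ p) (sym (x∈⁅y⁆⇒x≡y x y∈⁅x⁆)) x∈p

∪⁅⁆-least : ∀ {n} {p q : Subset n} {x} → p ⊆ₛ q → x ∈ₛ q → p ∪ ⁅ x ⁆ ⊆ₛ q
∪⁅⁆-least {p = p} {x = x} p⊆q x∈q y∈ with x∈p∪q⁻ p ⁅ x ⁆ y∈
... | inj₁ y∈p    = p⊆q y∈p
... | inj₂ y∈⁅x⁆ = x∈p⇒⁅x⁆⊆p x∈q y∈⁅x⁆

-- The graph G ∪ Bd(G)

module Subdivision (G : Graph) where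

  n : ℕ
  n = order G

  N[_] : Vertex G → Subset n
  N[ v ] = tabulate λ x → ⌊ v Fin.≟ x ⌋ ∨ adj G v x

  ∈N[]⁺ : ∀ {v x} → v ≡ x ⊎ Adj G v x → x ∈ₛ N[ v ]
  ∈N[]⁺ {v} {x} v∼⁼x = ∈-tabulate⁺ (decided (v Fin.≟ x) v∼⁼x)
    where
    decided : (v≟x : Dec (v ≡ x)) → v ≡ x ⊎ Adj G v x → (⌊ v≟x ⌋ ∨ adj G v x) ≡ true
    decided (yes _)  _           = refl
    decided (no v≢x) (inj₁ v≡x) = ⊥-elim (v≢x v≡x)
    decided (no _)   (inj₂ v∼x) = v∼x

  ∈N[]⁻ : ∀ {v x} → x ∈ₛ N[ v ] → v ≡ x ⊎ Adj G v x
  ∈N[]⁻ {v} {x} x∈ with v Fin.≟ x | ∈-tabulate⁻ x∈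
  ... | yes v≡x | _   = inj₁ v≡x
  ... | no _    | v∼x = inj₂ v∼x

  v∈N[v] : ∀ v → v ∈ₛ N[ v ]
  v∈N[v] v = ∈N[]⁺ (inj₁ refl)

  ∈N[]-sym : ∀ {v x} → x ∈ₛ N[ v ] → v ∈ₛ N[ x ]
  ∈N[]-sym {v} {x} x∈ with ∈N[]⁻ x∈
  ... | inj₁ refl = x∈
  ... | inj₂ v∼x  = ∈N[]⁺ (inj₂ (trans (adj-sym G x v) v∼x))

  IsClique : Subset n → Set
  IsClique S = ∀ {v} → v ∈ₛ S → S ⊆ₛ N[ v ]

  isCliqueᵇ⇒IsClique : ∀ S → isCliqueᵇ G S ≡ true → IsClique S
  isCliqueᵇ⇒IsClique S e {i} i∈S {j} j∈S =
    ∈-tabulate⁺ (not-∧-∨⇒ _ _ _ (allᵇ⇒ _ _ (allᵇ⇒ _ _ e (∈-allFin i)) (∈-allFin j))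
                  (Vec.[]=⇒lookup i∈S) (Vec.[]=⇒lookup j∈S))

  IsClique⇒isCliqueᵇ : ∀ S → IsClique S → isCliqueᵇ G S ≡ true
  IsClique⇒isCliqueᵇ S clique = ⇒allᵇ _ (allFin n) λ {i} _ → ⇒allᵇ _ (allFin n) λ {j} _ →
    ⇒not-∧-∨ _ _ _ λ i∈S j∈S →
      ∈-tabulate⁻ (clique (Vec.lookup⇒[]= i S i∈S) (Vec.lookup⇒[]= j S j∈S))

  ⁅⁆-clique : ∀ v → IsClique ⁅ v ⁆
  ⁅⁆-clique v x∈ y∈ =
    ∈N[]⁺ (inj₁ (trans (x∈⁅y⁆⇒x≡y v x∈) (sym (x∈⁅y⁆⇒x≡y v y∈))))

  ∪⁅⁆-clique : ∀ {σ v} → IsClique σ → σ ⊆ₛ N[ v ] → IsClique (σ ∪ ⁅ v ⁆)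
  ∪⁅⁆-clique {σ} {v} σ-clique σ⊆N[v] x∈ with x∈p∪q⁻ σ ⁅ v ⁆ x∈
  ... | inj₁ x∈σ = ∪⁅⁆-least (σ-clique x∈σ) (∈N[]-sym (σ⊆N[v] x∈σ))
  ... | inj₂ x∈⁅v⁆ rewrite x∈⁅y⁆⇒x≡y v x∈⁅v⁆ = ∪⁅⁆-least σ⊆N[v] (v∈N[v] v)

  ∈-cliques⁻ : ∀ {S} → S ∈ cliques G → Nonempty S × IsClique S
  ∈-cliques⁻ {S} S∈ =
    nonemptyᵇ⇒Nonempty S (Equivalence.to Bool.T-≡ (proj₁ ne×cl)) ,
    isCliqueᵇ⇒IsClique S (Equivalence.to Bool.T-≡ (proj₂ ne×cl))
    where
    ne×cl = Equivalence.to Bool.T-∧ (proj₂ (∈-filter⁻ _ {xs = allSubsets n} S∈))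

  ∈-cliques⁺ : ∀ {S} → Nonempty S → IsClique S → S ∈ cliques G
  ∈-cliques⁺ {S} ne cl = ∈-filter⁺ _ (∈-allSubsets n S)
    (Equivalence.from Bool.T-∧ (Equivalence.from Bool.T-≡ (Nonempty⇒nonemptyᵇ S ne) ,
                                Equivalence.from Bool.T-≡ (IsClique⇒isCliqueᵇ S cl)))

  cliques-unique : Unique (cliques G)
  cliques-unique = Unique.filter⁺ _ (allSubsets-unique n)

  _≟ₛ_ : DecidableEquality (Subset n)
  _≟ₛ_ = Vec.≡-dec Bool._≟_

  Point⊎Simplex : Set
  Point⊎Simplex = Vertex G ⊎ Subset n

  adjGBd : Point⊎Simplex → Point⊎Simplex → Bool
  adjGBd (inj₁ x) (inj₁ y) = adj G x y
  adjGBd (inj₁ x) (inj₂ S) = S ⊆ᵇ N[ x ]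
  adjGBd (inj₂ S) (inj₁ x) = S ⊆ᵇ N[ x ]
  adjGBd (inj₂ S) (inj₂ T) = bdAdj S T

  adjGBd-sym : ∀ x y → adjGBd x y ≡ adjGBd y x
  adjGBd-sym (inj₁ x) (inj₁ y) = adj-sym G x y
  adjGBd-sym (inj₁ x) (inj₂ S) = refl
  adjGBd-sym (inj₂ S) (inj₁ x) = refl
  adjGBd-sym (inj₂ S) (inj₂ T) = bdAdj-sym S T

  adjGBd-irrefl : ∀ x → adjGBd x x ≡ false
  adjGBd-irrefl (inj₁ x) = adj-irrefl G x
  adjGBd-irrefl (inj₂ S) = bdAdj-irrefl S

  open InducedGraphs (Sum.≡-dec Fin._≟_ _≟ₛ_) adjGBd adjGBd-sym adjGBd-irrefl

  ⊆⇒∼⁼ : ∀ {S T} → S ⊆ₛ T → inj₂ S ∼⁼ inj₂ T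
  ⊆⇒∼⁼ {S} {T} S⊆T with T ≟ₛ S
  ... | yes refl = inj₁ refl
  ... | no T≢S   = inj₂ (comparable⇒bdAdj S T (λ S≡T → T≢S (sym S≡T)) (inj₁ S⊆T))

  points : List (Vertex G) → List Point⊎Simplex
  points = map inj₁

  simplices : List (Subset n) → List Point⊎Simplex
  simplices = map inj₂

  simplices-points-unique : ∀ {Q R} → Unique Q → Unique R → Unique (simplices Q ++ points R)
  simplices-points-unique uQ uR =
    Unique.++⁺ (Unique.map⁺ Sum.inj₂-injective uQ) (Unique.map⁺ Sum.inj₁-injective uR)
               (λ (y∈₂ , y∈₁) → inj₁-inj₂-disjoint (y∈₁ , y∈₂))

  points-simplices-unique : ∀ {R Q} → Unique R → Unique Q → Unique (points R ++ simplices Q)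
  points-simplices-unique uR uQ =
    Unique.++⁺ (Unique.map⁺ Sum.inj₁-injective uR) (Unique.map⁺ Sum.inj₂-injective uQ)
               inj₁-inj₂-disjoint

  clique-nbhd-dismantlable : ∀ {σ Q} → σ ∈ cliques G → All (_∈ cliques G) Q → Unique Q →
    Dismantlableᴬ (NbrIn (simplices Q ++ points (allFin n)) (inj₂ σ))
  clique-nbhd-dismantlable {σ} {Q} σ∈C Q⊆C uQ with ∈-cliques⁻ σ∈C
  ... | (b , b∈σ) , σ-clique =
    cone-dismantlable (neighbours L (inj₂ σ))
      (neighbours-unique (inj₂ σ) (simplices-points-unique uQ (Unique.allFin⁺ n)))
      (neighbours-enumerates L (inj₂ σ))
      (inj₁ b)
      (∈-++⁺ʳ (simplices Q) (∈-map⁺ inj₁ (∈-allFin b)) , ⊆⇒⊆ᵇ σ N[ b ] (σ-clique b∈σ))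
      apex
    where
    L = simplices Q ++ points (allFin n)
    apex : ∀ y → NbrIn L (inj₂ σ) y → y ≢ inj₁ b → inj₁ b ∼ y
    apex (inj₁ w) (_ , σ∼w) w≢b with ∈N[]⁻ (⊆ᵇ⇒⊆ σ N[ w ] σ∼w b∈σ)
    ... | inj₁ refl = ⊥-elim (w≢b refl)
    ... | inj₂ w∼b  = trans (adj-sym G b w) w∼b
    apex (inj₂ τ) (τ∈L , σ∼τ) _ =
      ⊆⇒⊆ᵇ τ N[ b ] (τ⊆N[b] (proj₂ (bdAdj⇒comparable σ τ σ∼τ)))
      where
      τ-clique = proj₂ (∈-cliques⁻ (All.lookup Q⊆C (inj₂-∈⁻ τ∈L)))
      τ⊆N[b] : Comparable σ τ → τ ⊆ₛ N[ b ]
      τ⊆N[b] (inj₁ σ⊆τ) = τ-clique (σ⊆τ b∈σ)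
      τ⊆N[b] (inj₂ τ⊆σ) = λ x∈τ → σ-clique b∈σ (τ⊆σ x∈τ)

  add-cliques : ∀ Q → Unique Q → All (_∈ cliques G) Q →
                Star SStep (induced (points (allFin n))) (induced (simplices Q ++ points (allFin n)))
  add-cliques []      _          _           = ε
  add-cliques (σ ∷ Q) (σ∉Q ∷ uQ) (σ∈C ∷ Q⊆C) =
    add-cliques Q uQ Q⊆C
    ◅◅ add-step (simplices-points-unique (σ∉Q ∷ uQ) (Unique.allFin⁺ n))
                (clique-nbhd-dismantlable σ∈C Q⊆C uQ)
    ◅ ε

  module VertexDeletion (v : Vertex G) (R : List (Vertex G))
    (uM : Unique (points R ++ simplices (cliques G))) where

    M : List Point⊎Simplex
    M = points R ++ simplices (cliques G)

    simplex∈M : ∀ {τ} → τ ∈ cliques G → inj₂ τ ∈ M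
    simplex∈M τ∈C = ∈-++⁺ʳ (points R) (∈-map⁺ inj₂ τ∈C)

    clique∈M⁻ : ∀ {τ} → inj₂ τ ∈ M → IsClique τ
    clique∈M⁻ τ∈M = proj₂ (∈-cliques⁻ (inj₂-∈⁻ (++-comm (points R) _ τ∈M)))

    Misses : Point⊎Simplex → Set
    Misses (inj₁ _) = ⊥
    Misses (inj₂ τ) = v ∉ₛ τ

    misses? : Decidable Misses
    misses? (inj₁ _) = no λ ()
    misses? (inj₂ τ) = ¬? (v ∈? τ)

    Nbr : Point⊎Simplex → Set
    Nbr = NbrIn M (inj₁ v)

    Core Stray : Point⊎Simplex → Set
    Core  y = Nbr y × ¬ Misses y
    Stray y = Nbr y × Misses y

    core-or-stray⇒Nbr : ∀ {Ds y} → All Stray Ds → Core y ⊎ y ∈ Ds → Nbr y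
    core-or-stray⇒Nbr _      (inj₁ (y-nbr , _)) = y-nbr
    core-or-stray⇒Nbr strays (inj₂ y∈Ds)        = proj₁ (All.lookup strays y∈Ds)

    weight : Point⊎Simplex → ℕ
    weight (inj₁ _) = 0
    weight (inj₂ τ) = ∣ τ ∣

    core-dismantlable : Dismantlableᴬ Core
    core-dismantlable =
      cone-dismantlable (filter (¬? ∘ misses?) (neighbours M (inj₁ v)))
        (Unique.filter⁺ (¬? ∘ misses?) (neighbours-unique (inj₁ v) uM))
        (enumerates-filter (neighbours-enumerates M (inj₁ v)) (¬? ∘ misses?))
        (inj₂ ⁅ v ⁆) core-⁅v⁆ apex
      where
      core-⁅v⁆ : Core (inj₂ ⁅ v ⁆)
      core-⁅v⁆ = (simplex∈M (∈-cliques⁺ (v , x∈⁅x⁆ v) (⁅⁆-clique v)) ,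
                  ⊆⇒⊆ᵇ ⁅ v ⁆ N[ v ] (x∈p⇒⁅x⁆⊆p (v∈N[v] v))) ,
                 λ v∉⁅v⁆ → v∉⁅v⁆ (x∈⁅x⁆ v)
      apex : ∀ y → Core y → y ≢ inj₂ ⁅ v ⁆ → inj₂ ⁅ v ⁆ ∼ y
      apex (inj₁ w) ((_ , v∼w) , _) _ =
        ⊆⇒⊆ᵇ ⁅ v ⁆ N[ w ] (x∈p⇒⁅x⁆⊆p (∈N[]-sym (∈N[]⁺ (inj₂ v∼w))))
      apex (inj₂ τ) (_ , ¬v∉τ) τ≢⁅v⁆ =
        comparable⇒bdAdj ⁅ v ⁆ τ (λ eq → τ≢⁅v⁆ (cong inj₂ (sym eq)))
          (inj₁ (x∈p⇒⁅x⁆⊆p (decidable-stable (v ∈? τ) ¬v∉τ)))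

    module Enlarge {s : Subset n} (s∈M : inj₂ s ∈ M) (s∼v : inj₁ v ∼ inj₂ s) (v∉s : v ∉ₛ s)
      where

      s⁺ : Subset n
      s⁺ = s ∪ ⁅ v ⁆

      s⊆N[v] : s ⊆ₛ N[ v ]
      s⊆N[v] = ⊆ᵇ⇒⊆ s N[ v ] s∼v

      v∈s⁺ : v ∈ₛ s⁺
      v∈s⁺ = q⊆p∪q s ⁅ v ⁆ (x∈⁅x⁆ v)

      s⊆s⁺ : s ⊆ₛ s⁺
      s⊆s⁺ = p⊆p∪q ⁅ v ⁆

      core-s⁺ : Core (inj₂ s⁺)
      core-s⁺ = (simplex∈M (∈-cliques⁺ (v , v∈s⁺) (∪⁅⁆-clique (clique∈M⁻ s∈M) s⊆N[v])) ,
                 ⊆⇒⊆ᵇ s⁺ N[ v ] (∪⁅⁆-least s⊆N[v] (v∈N[v] v))) ,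
                λ v∉s⁺ → v∉s⁺ v∈s⁺

      s⁺≢s : s⁺ ≢ s
      s⁺≢s eq = v∉s (subst (v ∈ₛ_) eq v∈s⁺)

      -- A neighbour t ⊋ s either contains v, hence s⁺, or is a stray heavier than s.
      dominates : ∀ {Ds} → All Stray Ds → All (λ τ → weight τ ≤ ∣ s ∣) Ds →
                  Dominatedᴬ (λ y → Core y ⊎ y ∈ Ds) (inj₂ s) (inj₂ s⁺)
      dominates _ _ _ _ (inj₁ refl) = inj₂ (comparable⇒bdAdj s⁺ s s⁺≢s (inj₂ s⊆s⁺))
      dominates strays _ (inj₁ w) y∈ (inj₂ s∼w) =
        inj₂ (⊆⇒⊆ᵇ s⁺ N[ w ]
                (∪⁅⁆-least (⊆ᵇ⇒⊆ s N[ w ] s∼w) (∈N[]-sym (∈N[]⁺ (inj₂ v∼w)))))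
        where
        v∼w = proj₂ (core-or-stray⇒Nbr strays y∈)
      dominates _ heaviest (inj₂ t) y∈ (inj₂ s∼t) with bdAdj⇒comparable s t s∼t
      ... | _ , inj₂ t⊆s =
        inj₂ (comparable⇒bdAdj s⁺ t (λ s⁺≡t → v∉s (t⊆s (subst (v ∈ₛ_) s⁺≡t v∈s⁺)))
                                    (inj₂ (λ x∈t → s⊆s⁺ (t⊆s x∈t))))
      ... | s≢t , inj₁ s⊆t with v ∈? t
      ...   | yes v∈t = ⊆⇒∼⁼ (∪⁅⁆-least s⊆t v∈t)
      ...   | no v∉t  =
        ⊥-elim (<⇒≱ (p⊂q⇒∣p∣<∣q∣ (⊆∧≢⇒⊂ s⊆t s≢t))
                    (All.lookup heaviest (stray-member y∈ v∉t)))
        where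
        stray-member : ∀ {Ds} → Core (inj₂ t) ⊎ inj₂ t ∈ Ds → v ∉ₛ t → inj₂ t ∈ Ds
        stray-member (inj₁ (_ , ¬v∉t)) v∉t = ⊥-elim (¬v∉t v∉t)
        stray-member (inj₂ t∈Ds)       _   = t∈Ds

    stray-dominated : ∀ Ds σ → All Stray Ds → σ ∈ Ds → All (λ τ → weight τ ≤ weight σ) Ds →
                      Σ Point⊎Simplex λ σ' → Core σ' × Dominatedᴬ (λ y → Core y ⊎ y ∈ Ds) σ σ'
    stray-dominated Ds (inj₁ _) strays σ∈Ds _ = ⊥-elim (proj₂ (All.lookup strays σ∈Ds))
    stray-dominated Ds (inj₂ s) strays s∈Ds heaviest with All.lookup strays s∈Ds
    ... | (s∈M , s∼v) , v∉s = inj₂ s⁺ , core-s⁺ , dominates strays heaviest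
      where
      open Enlarge s∈M s∼v v∉s

    vertex-nbhd-dismantlable : Dismantlableᴬ Nbr
    vertex-nbhd-dismantlable =
      dismantlable-resp merge split
        (dismantlable-∪ {Q = Core} {Bad = Stray} (λ (_ , v∉) (_ , ¬v∉) → ¬v∉ v∉) weight
          stray-dominated core-dismantlable strays (All.tabulate (proj₁ (strays-enumerate _))))
      where
      strays = filter misses? (neighbours M (inj₁ v))
      strays-enumerate = enumerates-filter (neighbours-enumerates M (inj₁ v)) misses?
      merge : ∀ y → Core y ⊎ y ∈ strays → Nbr y
      merge y (inj₁ (y-nbr , _)) = y-nbr
      merge y (inj₂ y∈)          = proj₁ (proj₁ (strays-enumerate y) y∈)
      split : ∀ y → Nbr y → Core y ⊎ y ∈ strays
      split y y-nbr with misses? y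
      ... | yes y-misses = inj₂ (proj₂ (strays-enumerate y) (y-nbr , y-misses))
      ... | no ¬y-misses = inj₁ (y-nbr , ¬y-misses)

  delete-points : ∀ R → Unique R →
                  Star SStep (induced (points R ++ simplices (cliques G))) (induced (simplices (cliques G)))
  delete-points []      _          = ε
  delete-points (v ∷ R) (v∉R ∷ uR) =
    delete-step (points-simplices-unique (v∉R ∷ uR) cliques-unique)
      (VertexDeletion.vertex-nbhd-dismantlable v R (points-simplices-unique uR cliques-unique))
    ◅ delete-points R uR

  G≅points : Iso G (induced (points (allFin n)))
  G≅points = embedding-Iso G (Unique.map⁺ Sum.inj₁-injective (Unique.allFin⁺ n)) inj₁
    (λ _ _ → Sum.inj₁-injective) (λ x → ∈-map⁺ inj₁ (∈-allFin x))
    (λ y y∈ → let x , _ , eq = ∈-map⁻ inj₁ y∈ in x , sym eq) (λ _ _ → refl)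

  simplices-points≅points-simplices :
    Iso (induced (simplices (cliques G) ++ points (allFin n)))
        (induced (points (allFin n) ++ simplices (cliques G)))
  simplices-points≅points-simplices =
    same-members-Iso (simplices-points-unique cliques-unique (Unique.allFin⁺ n))
      (points-simplices-unique (Unique.allFin⁺ n) cliques-unique)
      (++-comm (simplices (cliques G)) _) (++-comm (points (allFin n)) _)

  simplices≅Bd : Iso (induced (simplices (cliques G))) (Bd G)
  simplices≅Bd = Iso-sym {Bd G} {induced (simplices (cliques G))} Bd≅simplices
    where
    Bd≅simplices : Iso (Bd G) (induced (simplices (cliques G)))
    Bd≅simplices = embedding-Iso (Bd G) (Unique.map⁺ Sum.inj₂-injective cliques-unique)
      (inj₂ ∘ lookup (cliques G))
      (λ i j eq → lookup-injective cliques-unique i j (Sum.inj₂-injective eq))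
      (λ i → ∈-map⁺ inj₂ (∈-lookup i))
      (λ y y∈ → let τ , τ∈ , eq = ∈-map⁻ inj₂ y∈ in
                index τ∈ , trans (cong inj₂ (sym (lookup-index τ∈))) (sym eq))
      (λ _ _ → refl)

proposition2p9 : (G : Graph) → SameSHomotopyType G (Bd G)
proposition2p9 G =
  iso G≅points
  ◅ add-cliques (cliques G) cliques-unique (All.tabulate id)
  ◅◅ iso simplices-points≅points-simplices
  ◅ delete-points (allFin n) (Unique.allFin⁺ n)
  ◅◅ iso simplices≅Bd
  ◅ ε
  where
  open Subdivision G
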